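{- Let $F=T[a\,..\,b]$ and $F'=T[a'\,..\,b']$ be neighboring runs of a string $T$ with $a<a'$, the same period $p$ and equal Lyndon roots, and let $\mathcal{R}=\{T[x\,..\,y]\in\mathbf{P}(F,F') : x,y\in(a\,..\,b')\}$. Then there is at most one run in $\mathbf{P}(F,F')\setminus\mathcal{R}$.
   Context: Strings are 0-indexed; $T[i\,..\,j]$ is a fragment; $(a\,..\,b')=\{a+1,\dots,b'-1\}$. A positive integer $r\le |S|$ is a period of $S$ if $S[i]=S[i+r]$ for all valid $i$; $\mathrm{per}(S)$ is the smallest period; $S$ is periodic if $\mathrm{per}(S)\le|S|/2$. A run of $T$ is a periodic fragment $T[a\,..\,b]$ with $r=\mathrm{per}(T[a\,..\,b])$ such that ($a=0$ or $T[a-1]\ne T[a-1+r]$) and ($b=|T|-1$ or $T[b+1]\ne T[b+1-r]$). The Lyndon root of a periodic string $S$ is the lexicographically smallest rotation of $S[0\,..\,\mathrm{per}(S))$. Fragments $T[a\,..\,b]$, $T[a'\,..\,b']$ are neighboring if $[a-1\,..\,b+1]\cap[a'\,..\,b']\ne\emptyset$; then $F\cup F'=T[\min(a,a')\,..\,\max(b,b')]$ and $F\cap F'=T[\max(a,a')\,..\,\min(b,b')]$. A square $X^2$ is generated by a periodic fragment $U$ if $X^2$ is a fragment contained in $U$ with $\mathrm{per}(X^2)=\mathrm{per}(U)$; $\mathrm{frag\text{ - }squares}(U)$ is the set of these. $\mathrm{subper}(U)=\min\{\mathrm{per}(X):X^2\in\mathrm{frag\text{ - }squares}(U)\}$; $U$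 is subperiodic if $\mathrm{subper}(U)\le\mathrm{per}(U)/4$. The pyramid $\mathbf{P}(F,F')$ is the set of subperiodic runs $R$ of $T$ with $\mathrm{subper}(R)=p$ such that $R\cap(F\cup F')$ is periodic with period $\mathrm{per}(R)$. -}

module Defs where

open import Data.Nat using (ℕ; zero; suc; _+_; _*_; _∸_; _≤_; _<_; _⊔_; _⊓_; _%_)
open import Data.Product using (Σ; _×_; _,_; ∃)
open import Data.Sum using (_⊎_)
open import Relation.Binary.PropositionalEquality using (_≡_; _≢_)
open import Relation.Nullary using (¬_)

-- A string T of length n over alphabet A is modelled as a function ℕ → A of
-- which only the positions 0 .. n-1 are relevant.  A fragment T[i .. j] is
-- given by its endpoints (inclusive, 0-indexed).

len : ℕ → ℕ → ℕ
len i j = suc j ∸ i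

Fragment : ℕ → ℕ → ℕ → Set
Fragment n i j = i ≤ j × j < n

HasPeriod : {A : Set} → (ℕ → A) → ℕ → ℕ → ℕ → Set
HasPeriod T i j r =
  1 ≤ r × r ≤ len i j × (∀ k → i ≤ k → k + r ≤ j → T k ≡ T (k + r))

IsPer : {A : Set} → (ℕ → A) → ℕ → ℕ → ℕ → Set
IsPer T i j r = HasPeriod T i j r × (∀ r′ → HasPeriod T i j r′ → r ≤ r′)

PeriodicWith : {A : Set} → (ℕ → A) → ℕ → ℕ → ℕ → Set
PeriodicWith T i j r = IsPer T i j r × 2 * r ≤ len i j

IsRun : {A : Set} → ℕ → (ℕ → A) → ℕ → ℕ → ℕ → Set
IsRun n T a b r =
  Fragment n a b × PeriodicWith T a b r
  × (a ≡ 0 ⊎ Σ ℕ (λ a₀ → a ≡ suc a₀ × T a₀ ≢ T (a₀ + r)))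
  × (suc b ≡ n ⊎ T (suc b) ≢ T (suc b ∸ r))

-- X² = T[i .. i+2ℓ-1] (with X = T[i .. i+ℓ-1], ℓ ≥ 1) belongs to
-- frag-squares(T[x .. y]), where per(T[x .. y]) = r
InFragSquares : {A : Set} → (ℕ → A) → ℕ → ℕ → ℕ → ℕ → ℕ → Set
InFragSquares T x y r i ℓ =
  1 ≤ ℓ × x ≤ i × i + 2 * ℓ ≤ suc y
  × (∀ k → k < ℓ → T (i + k) ≡ T (i + ℓ + k))
  × IsPer T i (i + 2 * ℓ ∸ 1) r

IsSubper : {A : Set} → (ℕ → A) → ℕ → ℕ → ℕ → ℕ → Set
IsSubper T x y r q =
  Σ ℕ (λ i → Σ ℕ (λ ℓ → InFragSquares T x y r i ℓ × IsPer T i (i + ℓ ∸ 1) q))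
  × (∀ i ℓ q′ → InFragSquares T x y r i ℓ → IsPer T i (i + ℓ ∸ 1) q′ → q ≤ q′)

-- Neighboring fragments: [a-1 .. b+1] ∩ [a' .. b'] ≠ ∅
Neighboring : ℕ → ℕ → ℕ → ℕ → Set
Neighboring a b a′ b′ = Σ ℕ (λ z → a ≤ suc z × z ≤ suc b × a′ ≤ z × z ≤ b′)

LexLeq : {A : Set} → (A → A → Set) → ℕ → (ℕ → A) → (ℕ → A) → Set
LexLeq _<ₐ_ p u v =
  (∀ j → j < p → u j ≡ v j)
  ⊎ Σ ℕ (λ i → i < p × (∀ j → j < i → u j ≡ v j) × u i <ₐ v i)

rotation : {A : Set} → (ℕ → A) → ℕ → (p : ℕ) → ℕ → ℕ → A
rotation T a zero k j = T a
rotation T a (suc p′) k j = T (a + ((k + j) % suc p′))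

IsLyndonRoot : {A : Set} → (A → A → Set) → (ℕ → A) → ℕ → ℕ → (ℕ → A) → Set
IsLyndonRoot _<ₐ_ T a p L =
  Σ ℕ (λ k → k < p × (∀ j → j < p → L j ≡ rotation T a p k j))
  × (∀ k′ → k′ < p → LexLeq _<ₐ_ p L (rotation T a p k′))

InPyramid : {A : Set} → ℕ → (ℕ → A) → ℕ → ℕ → ℕ → ℕ → ℕ → ℕ → ℕ → Set
InPyramid n T a b a′ b′ p x y =
  Σ ℕ (λ r →
    IsRun n T x y r
    × IsSubper T x y r p
    × 4 * p ≤ r                   -- R is subperiodic
    -- R ∩ (F ∪ F') = T[max(x,a) .. min(y, max(b,b'))] (F ∪ F' = T[min(a,a') .. max(b,b')])
    × (x ⊔ (a ⊓ a′)) ≤ (y ⊓ (b ⊔ b′))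
    × PeriodicWith T (x ⊔ (a ⊓ a′)) (y ⊓ (b ⊔ b′)) r)

-- If x ≤ a, then R ∩ (F ∪ F′) starts at a and has
-- minimal period r; comparing it with the runs F and F′ shows that the shift
-- by r carries the first p letters of F onto p letters of F′ starting in
-- [a′ .. a′ + p), and that y ≥ b + r unless y ≥ b′.  Symmetrically, if y ≥ b′
-- the shift by r carries p letters ending in the last p positions of F onto
-- the last p letters of F′, and x + r ≤ a′ unless x ≤ a.  Two runs on the
-- same side with periods r₁ < r₂ would exhibit two equal length-p windows at
-- distance r₂ − r₁ < p inside F or F′, giving it a period smaller than p; so
-- both runs have the same period and share a window of length r, hence
-- coincide.  A run with x ≤ a, y < b′ and one with x > a, y ≥ b′ would force
-- both r₁ < r₂ and r₂ < r₁.

module Submission where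

open import Defs
open import Data.Nat
open import Data.Nat.Properties
open import Data.Nat.Tactic.RingSolver using (solve)
open import Data.Nat.Induction using (<-rec)
open import Data.List using (_∷_; [])
open import Data.Product using (Σ; _×_; _,_; proj₁; proj₂)
open import Data.Sum using (inj₁; inj₂)
open import Data.Empty using (⊥; ⊥-elim)
open import Relation.Binary.PropositionalEquality
open import Relation.Nullary using (¬_; yes; no)
open import Relation.Binary.Structures using (IsStrictTotalOrder)
open import Algebra.Properties.CommutativeSemigroup +-commutativeSemigroup
  using () renaming (xy∙z≈xz∙y to +-right-comm)
open ≡-Reasoning

WeakPeriod : {A : Set} → (ℕ → A) → ℕ → ℕ → ℕ → Set
WeakPeriod T s e r = ∀ k → s ≤ k → k + r ≤ e → T k ≡ T (k + r)

infixl 6 _⊕_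
_⊕_ : ∀ {m n o q} → m ≤ n → o ≤ q → m + o ≤ n + q
_⊕_ = +-mono-≤

-- A linear inequality m ≤ n certified by a sum L ≤ R of hypotheses: after
-- adding C to both sides (and discarding S from R) the two sides agree.
≤-by-sum : ∀ {L R m n} C S → L ≤ R → m + C ≡ L → R + S ≡ n + C → m ≤ n
≤-by-sum {R = R} {m} {n} C S L≤R refl eq =
  +-cancelʳ-≤ C m n (subst (m + C ≤_) eq (≤-trans L≤R (m≤m+n R S)))

<-offset : ∀ {m n} → m < n → Σ ℕ λ d → 0 < d × m + d ≡ n
<-offset {m} (s≤s m≤n) = suc (_ ∸ m) , s≤s z≤n , trans (+-suc m _) (cong suc (m+[n∸m]≡n m≤n))

≤-offset : ∀ {m n j} → m + n ≤ j → Σ ℕ λ i → m ≤ i × i + n ≡ j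
≤-offset {m} {n} {j} h = j ∸ n , +-cancelʳ-≤ n m (j ∸ n) (subst (m + n ≤_) (sym j∸n+n≡j) h) , j∸n+n≡j
  where
  j∸n+n≡j : j ∸ n + n ≡ j
  j∸n+n≡j = m∸n+n≡m (m+n≤o⇒n≤o m h)

module _ {A : Set} (T : ℕ → A) where

  -- Inside two p-periodic fragments, T j ≡ T (j + r) is invariant under j ↦ j ± p,
  -- so one window of p consecutive positions propagates it to the whole overlap.
  shift-transfer : ∀ {s e s′ e′ p r w} → WeakPeriod T s e p → WeakPeriod T s′ e′ p → 1 ≤ p
    → s ≤ w → w + p ≤ suc e → s′ ≤ w + r → w + p + r ≤ suc e′
    → (∀ k → k < p → T (w + k) ≡ T (w + k + r))
    → ∀ j → s ≤ j → j ≤ e → s′ ≤ j + r → j + r ≤ e′ → T j ≡ T (j + r)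
  shift-transfer {s} {e} {s′} {e′} {p} {r} {w} per per′ 1≤p s≤w w+p≤ s′≤w+r w+p+r≤ window = transfer
    where
    upward : ∀ j → w ≤ j → j ≤ e → j + r ≤ e′ → T j ≡ T (j + r)
    upward = <-rec _ step
      where
      step : ∀ j → (∀ {i} → i < j → w ≤ i → i ≤ e → i + r ≤ e′ → T i ≡ T (i + r))
           → w ≤ j → j ≤ e → j + r ≤ e′ → T j ≡ T (j + r)
      step j rec w≤j j≤e j+r≤e′ with j <? w + p | m≤n⇒∃[o]m+o≡n w≤j
      ... | yes j<w+p | k , refl = window k (+-cancelˡ-< w k p j<w+p)
      ... | no j≮w+p | _ with ≤-offset {w} {p} (≮⇒≥ j≮w+p)
      ...   | i , w≤i , refl = begin
        T (i + p)      ≡⟨ sym (per i (≤-trans s≤w w≤i) j≤e) ⟩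
        T i            ≡⟨ rec (m<m+n i 1≤p) w≤i (≤-trans (m≤m+n i p) j≤e) (≤-trans (+-monoˡ-≤ r (m≤m+n i p)) j+r≤e′) ⟩
        T (i + r)      ≡⟨ per′ (i + r) (≤-trans s′≤w+r (+-monoˡ-≤ r w≤i)) (subst (_≤ e′) (+-right-comm i p r) j+r≤e′) ⟩
        T (i + r + p)  ≡⟨ cong T (+-right-comm i r p) ⟩
        T (i + p + r)  ∎
    downward : ∀ m j → w ≤ j + m → j < w → s ≤ j → s′ ≤ j + r → T j ≡ T (j + r)
    downward zero j w≤j+0 j<w _ _ = ⊥-elim (<⇒≱ j<w (subst (w ≤_) (+-identityʳ j) w≤j+0))
    downward (suc m) j w≤j+m j<w s≤j s′≤j+r = begin
      T j            ≡⟨ per j s≤j j+p≤e ⟩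
      T (j + p)      ≡⟨ next ⟩
      T (j + p + r)  ≡⟨ cong T (+-right-comm j p r) ⟩
      T (j + r + p)  ≡⟨ sym (per′ (j + r) s′≤j+r (subst (_≤ e′) (+-right-comm j p r) j+p+r≤e′)) ⟩
      T (j + r)      ∎
      where
      j+p≤e : j + p ≤ e
      j+p≤e = s≤s⁻¹ (≤-trans (+-monoˡ-< p j<w) w+p≤)
      j+p+r≤e′ : j + p + r ≤ e′
      j+p+r≤e′ = s≤s⁻¹ (≤-trans (+-monoˡ-< r (+-monoˡ-< p j<w)) w+p+r≤)
      next : T (j + p) ≡ T (j + p + r)
      next with w ≤? j + p
      ... | yes w≤j+p = upward (j + p) w≤j+p j+p≤e j+p+r≤e′
      ... | no w≰j+p = downward m (j + p) (≤-by-sum 1 0 (w≤j+m ⊕ 1≤p) (solve (w ∷ [])) (solve (j ∷ m ∷ p ∷ [])))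
                         (≰⇒> w≰j+p) (≤-trans s≤j (m≤m+n j p)) (≤-trans s′≤j+r (+-monoˡ-≤ r (m≤m+n j p)))
    transfer : ∀ j → s ≤ j → j ≤ e → s′ ≤ j + r → j + r ≤ e′ → T j ≡ T (j + r)
    transfer j s≤j j≤e s′≤j+r j+r≤e′ with w ≤? j
    ... | yes w≤j = upward j w≤j j≤e j+r≤e′
    ... | no w≰j = downward w j (m≤n+m w j) (≰⇒> w≰j) s≤j s′≤j+r

  per≤window-period : ∀ {s e P w d} → IsPer T s e P → 1 ≤ d → s ≤ w → w + P + d ≤ suc e
    → (∀ k → k < P → T (w + k) ≡ T (w + k + d)) → P ≤ d
  per≤window-period {s} {e} {P} {w} {d} ((1≤P , _ , per) , minimal) 1≤d s≤w w+P+d≤ window =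
    minimal d (1≤d , d≤len , d-period)
    where
    d-period : WeakPeriod T s e d
    d-period j s≤j j+d≤e =
      shift-transfer per per 1≤P s≤w (m+n≤o⇒m≤o (w + P) w+P+d≤) (≤-trans s≤w (m≤m+n w d)) w+P+d≤ window
        j s≤j (m+n≤o⇒m≤o j j+d≤e) (≤-trans s≤j (m≤m+n j d)) j+d≤e
    s+d≤ : s + d ≤ suc e
    s+d≤ = ≤-trans (+-monoˡ-≤ d (≤-trans s≤w (m≤m+n w P))) w+P+d≤
    d≤len : d ≤ len s e
    d≤len = subst (_≤ suc e ∸ s) (m+n∸m≡n s d) (∸-monoˡ-≤ s s+d≤)

module _ {A : Set} {n : ℕ} {T : ℕ → A} {x y r : ℕ} (R : IsRun n T x y r) where

  run-isPer : IsPer T x y r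
  run-isPer = proj₁ (proj₁ (proj₂ R))

  run-period : WeakPeriod T x y r
  run-period = proj₂ (proj₂ (proj₁ run-isPer))

  run-end<n : y < n
  run-end<n = proj₂ (proj₁ R)

  run-left-maximal : ∀ i → suc i ≡ x → T i ≢ T (i + r)
  run-left-maximal i 1+i≡x with proj₁ (proj₂ (proj₂ R))
  ... | inj₁ x≡0 = λ _ → 0≢1+n (trans (sym x≡0) (sym 1+i≡x))
  ... | inj₂ (x₀ , x≡1+x₀ , T[x₀]≢T[x₀+r]) with suc-injective (trans 1+i≡x x≡1+x₀)
  ...   | refl = T[x₀]≢T[x₀+r]

  run-right-maximal : ∀ i → i + r ≡ suc y → suc y < n → T i ≢ T (i + r)
  run-right-maximal i i+r≡1+y 1+y<n T[i]≡T[i+r] with proj₂ (proj₂ (proj₂ R))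
  ... | inj₁ 1+y≡n = <-irrefl 1+y≡n 1+y<n
  ... | inj₂ T[1+y]≢ = T[1+y]≢ (begin
    T (suc y)      ≡⟨ cong T (sym i+r≡1+y) ⟩
    T (i + r)      ≡⟨ sym T[i]≡T[i+r] ⟩
    T i            ≡⟨ cong T (sym (m+n∸n≡m i r)) ⟩
    T (i + r ∸ r)  ≡⟨ cong (λ z → T (z ∸ r)) i+r≡1+y ⟩
    T (suc y ∸ r)  ∎)

module _ {A : Set} {n : ℕ} {T : ℕ → A} {x₁ y₁ x₂ y₂ r c : ℕ}
         (R₁ : IsRun n T x₁ y₁ r) (R₂ : IsRun n T x₂ y₂ r) where

  run-start-≤ : x₁ ≤ c → c + r ≤ suc y₂ → x₁ ≤ x₂
  run-start-≤ x₁≤c c+r≤ with proj₁ (proj₂ (proj₂ R₁))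
  ... | inj₁ refl = z≤n
  ... | inj₂ (x₀ , refl , T[x₀]≢T[x₀+r]) with suc x₀ ≤? x₂
  ...   | yes x₁≤x₂ = x₁≤x₂
  ...   | no x₁≰x₂ = ⊥-elim (T[x₀]≢T[x₀+r] (run-period R₂ x₀ (s≤s⁻¹ (≰⇒> x₁≰x₂))
                        (s≤s⁻¹ (≤-trans (+-monoˡ-≤ r x₁≤c) c+r≤))))

  run-end-≤ : x₂ ≤ c → c + r ≤ suc y₁ → y₂ ≤ y₁
  run-end-≤ x₂≤c c+r≤ with y₂ ≤? y₁ | ≤-offset {c} {r} c+r≤
  ... | yes y₂≤y₁ | _ = y₂≤y₁
  ... | no y₂≰y₁ | i , c≤i , i+r≡1+y₁ = ⊥-elim (run-right-maximal R₁ i i+r≡1+y₁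
          (≤-<-trans (≰⇒> y₂≰y₁) (run-end<n R₂))
          (run-period R₂ i (≤-trans x₂≤c c≤i) (subst (_≤ y₂) (sym i+r≡1+y₁) (≰⇒> y₂≰y₁))))

runs-equal : ∀ {A : Set} {n : ℕ} {T : ℕ → A} {x₁ y₁ x₂ y₂ r c : ℕ}
  → IsRun n T x₁ y₁ r → IsRun n T x₂ y₂ r
  → x₁ ≤ c → x₂ ≤ c → c + r ≤ suc y₁ → c + r ≤ suc y₂ → x₁ ≡ x₂ × y₁ ≡ y₂
runs-equal R₁ R₂ x₁≤c x₂≤c c+r≤₁ c+r≤₂ =
  ≤-antisym (run-start-≤ R₁ R₂ x₁≤c c+r≤₂) (run-start-≤ R₂ R₁ x₂≤c c+r≤₁) ,
  ≤-antisym (run-end-≤ R₂ R₁ x₁≤c c+r≤₂) (run-end-≤ R₁ R₂ x₂≤c c+r≤₁)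

periodic⇒long : ∀ {A : Set} {T : ℕ → A} {s e r} → s ≤ e → PeriodicWith T s e r → s + 2 * r ≤ suc e
periodic⇒long {s = s} {e} {r} s≤e (_ , 2r≤len) =
  subst (s + 2 * r ≤_) (m+[n∸m]≡n (m≤n⇒m≤1+n s≤e)) (+-monoʳ-≤ s 2r≤len)

-- F′ starts at a′ = suc a₀, which is possible since a < a′; the neighbouring
-- condition then reads a₀ ≤ b.
module NeighbouringRuns {A : Set} {n : ℕ} {T : ℕ → A} {a b a₀ b′ p : ℕ}
  (F : IsRun n T a b p) (F′ : IsRun n T (suc a₀) b′ p) (a≤a₀ : a ≤ a₀) (a₀≤b : a₀ ≤ b) where

  1≤p : 1 ≤ p
  1≤p = proj₁ (proj₁ (run-isPer F))

  perF : WeakPeriod T a b p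
  perF = run-period F

  perF′ : WeakPeriod T (suc a₀) b′ p
  perF′ = run-period F′

  longF : a + 2 * p ≤ suc b
  longF = periodic⇒long (proj₁ (proj₁ F)) (proj₁ (proj₂ F))

  longF′ : suc a₀ + 2 * p ≤ suc b′
  longF′ = periodic⇒long (proj₁ (proj₁ F′)) (proj₁ (proj₂ F′))

  a+p≤1+b : a + p ≤ suc b
  a+p≤1+b = ≤-by-sum p p longF (solve (a ∷ p ∷ [])) (solve (b ∷ p ∷ []))

  F′-left-maximal : T a₀ ≢ T (a₀ + p)
  F′-left-maximal = run-left-maximal F′ a₀ refl

  b<b′ : b < b′
  b<b′ with b <? b′
  ... | yes b<b′ = b<b′
  ... | no b≮b′ = ⊥-elim (F′-left-maximal (perF a₀ a≤a₀ (≤-trans a₀+p≤b′ (≮⇒≥ b≮b′))))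
    where
    a₀+p≤b′ : a₀ + p ≤ b′
    a₀+p≤b′ = ≤-by-sum (1 + p) p longF′ (solve (a₀ ∷ p ∷ [])) (solve (b′ ∷ p ∷ []))

  F-right-maximal : ∀ v → v + p ≡ suc b → T v ≢ T (v + p)
  F-right-maximal v v+p≡1+b = run-right-maximal F v v+p≡1+b (≤-<-trans b<b′ (run-end<n F′))

  p<r : ∀ {r} → 4 * p ≤ r → p < r
  p<r {r} 4p≤r = ≤-by-sum (3 * p) (2 * p) (4p≤r ⊕ 1≤p) (solve (p ∷ [])) (solve (r ∷ p ∷ []))

  record LeftShift (y r : ℕ) : Set where
    field
      a′≤a+r : suc a₀ ≤ a + r
      a+r<a′+p : a + r < suc a₀ + p
      a+r≤1+y : a + r ≤ suc y
      window : ∀ k → k < p → T (a + k) ≡ T (a + k + r)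
      y<b′⇒b+r≤y : y < b′ → b + r ≤ y

  module LeftRun {x y r e : ℕ} (R : IsRun n T x y r) (4p≤r : 4 * p ≤ r) (G : IsPer T a e r)
    (long : a + 2 * r ≤ suc e) (e≤y : e ≤ y) (e≤b′ : e ≤ b′) where

    perG : WeakPeriod T a e r
    perG = proj₂ (proj₂ (proj₁ G))

    p≤r : p ≤ r
    p≤r = <⇒≤ (p<r 4p≤r)

    a+r≤1+y : a + r ≤ suc y
    a+r≤1+y = ≤-trans (+-monoʳ-≤ a (m≤m+n r _)) (≤-trans long (s≤s e≤y))

    a′≤a+r : suc a₀ ≤ a + r
    a′≤a+r with suc a₀ ≤? a + r | a₀ + p ≤? e
    ... | yes a′≤a+r | _ = a′≤a+r
    ... | no a′≰a+r | yes a₀+p≤e with ≤-offset {a} {r} (s≤s⁻¹ (≰⇒> a′≰a+r))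
    ...   | i , a≤i , i+r≡a₀ = ⊥-elim (F′-left-maximal (begin
      T a₀           ≡⟨ cong T (sym i+r≡a₀) ⟩
      T (i + r)      ≡⟨ sym (perG i a≤i (≤-trans (≤-reflexive i+r≡a₀) (m+n≤o⇒m≤o a₀ a₀+p≤e))) ⟩
      T i            ≡⟨ perF i a≤i (≤-trans (+-monoʳ-≤ i p≤r) (≤-trans (≤-reflexive i+r≡a₀) a₀≤b)) ⟩
      T (i + p)      ≡⟨ perG (i + p) (≤-trans a≤i (m≤m+n i p)) (subst (_≤ e) (sym i+p+r≡a₀+p) a₀+p≤e) ⟩
      T (i + p + r)  ≡⟨ cong T i+p+r≡a₀+p ⟩
      T (a₀ + p)     ∎))
      where
      i+p+r≡a₀+p : i + p + r ≡ a₀ + p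
      i+p+r≡a₀+p = trans (+-right-comm i p r) (cong (_+ p) i+r≡a₀)
    a′≤a+r | no _ | no a₀+p≰e = ⊥-elim (<⇒≱ (p<r 4p≤r) (per≤window-period T G 1≤p ≤-refl a+r+p≤1+e window-p))
      where
      a+r+p≤1+b : a + r + p ≤ suc b
      a+r+p≤1+b = ≤-by-sum (r + suc e + a₀ + 3 * p) (1 + 2 * p) (long ⊕ ≰⇒> a₀+p≰e ⊕ a₀≤b ⊕ 4p≤r)
                    (solve (a ∷ r ∷ e ∷ a₀ ∷ p ∷ [])) (solve (a ∷ r ∷ e ∷ a₀ ∷ p ∷ b ∷ []))
      a+r+p≤1+e : a + r + p ≤ suc e
      a+r+p≤1+e = ≤-by-sum r 0 (long ⊕ p≤r) (solve (a ∷ r ∷ p ∷ [])) (solve (r ∷ e ∷ []))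
      window-p : ∀ k → k < r → T (a + k) ≡ T (a + k + p)
      window-p k k<r = perF (a + k) (m≤m+n a k) (s≤s⁻¹ (≤-trans (+-monoˡ-< p (+-monoʳ-< a k<r)) a+r+p≤1+b))

    a+r≤a₀+p : a + r ≤ a₀ + p
    a+r≤a₀+p with a + r ≤? a₀ + p
    ... | yes a+r≤a₀+p = a+r≤a₀+p
    ... | no a+r≰a₀+p = ⊥-elim (F′-left-maximal (begin
      T a₀           ≡⟨ perG a₀ a≤a₀ (≤-trans (+-monoˡ-≤ r (m≤m+n a₀ p)) a₀+p+r≤e) ⟩
      T (a₀ + r)     ≡⟨ perF′ (a₀ + r) (m<m+n a₀ (≤-trans 1≤p p≤r)) (subst (_≤ b′) (+-right-comm a₀ p r) (≤-trans a₀+p+r≤e e≤b′)) ⟩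
      T (a₀ + r + p) ≡⟨ cong T (+-right-comm a₀ r p) ⟩
      T (a₀ + p + r) ≡⟨ sym (perG (a₀ + p) (≤-trans a≤a₀ (m≤m+n a₀ p)) a₀+p+r≤e) ⟩
      T (a₀ + p)     ∎))
      where
      a₀+p+r≤e : a₀ + p + r ≤ e
      a₀+p+r≤e = ≤-by-sum (1 + a + r) 0 (≰⇒> a+r≰a₀+p ⊕ long) (solve (a₀ ∷ p ∷ r ∷ a ∷ [])) (solve (a ∷ r ∷ e ∷ []))

    window : ∀ k → k < p → T (a + k) ≡ T (a + k + r)
    window k k<p = perG (a + k) (m≤m+n a k)
      (≤-by-sum (1 + p + r) 0 (k<p ⊕ p≤r ⊕ long) (solve (a ∷ k ∷ r ∷ p ∷ [])) (solve (p ∷ r ∷ e ∷ [])))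

    y<b′⇒b+r≤y : y < b′ → b + r ≤ y
    y<b′⇒b+r≤y y<b′ with b + r ≤? y | ≤-offset {a} {r} a+r≤1+y
    ... | yes b+r≤y | _ = b+r≤y
    ... | no b+r≰y | j , a≤j , j+r≡1+y = ⊥-elim (run-right-maximal R j j+r≡1+y (≤-<-trans y<b′ (run-end<n F′))
          (shift-transfer T perF perF′ 1≤p ≤-refl a+p≤1+b a′≤a+r a+p+r≤1+b′ window
             j a≤j j≤b (≤-trans a′≤a+r (+-monoˡ-≤ r a≤j)) (subst (_≤ b′) (sym j+r≡1+y) y<b′)))
      where
      a+p+r≤1+b′ : a + p + r ≤ suc b′
      a+p+r≤1+b′ = ≤-by-sum (suc a₀ + p) 1 (a+r≤a₀+p ⊕ longF′)
                     (solve (a ∷ p ∷ r ∷ a₀ ∷ [])) (solve (a₀ ∷ p ∷ b′ ∷ []))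
      j≤b : j ≤ b
      j≤b = +-cancelʳ-≤ r j b (subst (_≤ b + r) (sym j+r≡1+y) (≰⇒> b+r≰y))

  left-shift : ∀ {x y r e} → IsRun n T x y r → 4 * p ≤ r → IsPer T a e r → a + 2 * r ≤ suc e
    → e ≤ y → e ≤ b′ → LeftShift y r
  left-shift R 4p≤r G long e≤y e≤b′ = record
    { a′≤a+r = a′≤a+r ; a+r<a′+p = s≤s a+r≤a₀+p ; a+r≤1+y = a+r≤1+y
    ; window = window ; y<b′⇒b+r≤y = y<b′⇒b+r≤y }
    where open LeftRun R 4p≤r G long e≤y e≤b′

  record RightShift (x y r u : ℕ) : Set where
    field
      b′≤b+r : b′ ≤ b + r
      b+r<b′+p : b + r < b′ + p
      u+r+p≡1+b′ : u + r + p ≡ suc b′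
      a≤u : a ≤ u
      x≤u : x ≤ u
      u+r≤1+y : u + r ≤ suc y
      window : ∀ k → k < p → T (u + k) ≡ T (u + k + r)
      a<x⇒x+r≤a′ : a < x → x + r ≤ suc a₀

  module RightRun {x y r s u v : ℕ} (R : IsRun n T x y r) (4p≤r : 4 * p ≤ r) (G : IsPer T s b′ r)
    (long : s + 2 * r ≤ suc b′) (a≤s : a ≤ s) (x≤s : x ≤ s)
    (s≤u : s ≤ u) (u+r+p≡1+b′ : u + r + p ≡ suc b′) (v+p≡1+b : v + p ≡ suc b) where

    perG : WeakPeriod T s b′ r
    perG = proj₂ (proj₂ (proj₁ G))

    p≤r : p ≤ r
    p≤r = <⇒≤ (p<r 4p≤r)

    b′≤b+r : b′ ≤ b + r
    b′≤b+r with b′ ≤? b + r | s ≤? v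
    ... | yes b′≤b+r | _ = b′≤b+r
    ... | no b′≰b+r | yes s≤v = ⊥-elim (F-right-maximal v v+p≡1+b (begin
      T v            ≡⟨ perG v s≤v (≤-trans (+-monoˡ-≤ r (m≤m+n v p)) v+p+r≤b′) ⟩
      T (v + r)      ≡⟨ perF′ (v + r) a′≤v+r (subst (_≤ b′) (+-right-comm v p r) v+p+r≤b′) ⟩
      T (v + r + p)  ≡⟨ cong T (+-right-comm v r p) ⟩
      T (v + p + r)  ≡⟨ sym (perG (v + p) (≤-trans s≤v (m≤m+n v p)) v+p+r≤b′) ⟩
      T (v + p)      ∎))
      where
      v+p+r≤b′ : v + p + r ≤ b′
      v+p+r≤b′ = subst (λ z → z + r ≤ b′) (sym v+p≡1+b) (≰⇒> b′≰b+r)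
      a′≤v+r : suc a₀ ≤ v + r
      a′≤v+r = ≤-trans (s≤s a₀≤b) (≤-trans (≤-reflexive (sym v+p≡1+b)) (+-monoʳ-≤ v p≤r))
    ... | no _ | no s≰v = ⊥-elim (<⇒≱ (p<r 4p≤r) (per≤window-period T G 1≤p s≤u (≤-reflexive u+r+p≡1+b′) window-p))
      where
      a′≤u : suc a₀ ≤ u
      a′≤u = ≤-by-sum (b + v + s + b′ + 2 * r + 4 * p + 3) (2 * p + 1)
               (s≤s a₀≤b ⊕ ≤-reflexive (sym v+p≡1+b) ⊕ ≰⇒> s≰v ⊕ long ⊕ ≤-reflexive (sym u+r+p≡1+b′) ⊕ 4p≤r)
               (solve (a₀ ∷ b ∷ v ∷ s ∷ b′ ∷ r ∷ p ∷ [])) (solve (u ∷ b ∷ v ∷ s ∷ b′ ∷ r ∷ p ∷ []))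
      window-p : ∀ k → k < r → T (u + k) ≡ T (u + k + p)
      window-p k k<r = perF′ (u + k) (≤-trans a′≤u (m≤m+n u k))
        (s≤s⁻¹ (≤-trans (+-monoˡ-< p (+-monoʳ-< u k<r)) (≤-reflexive u+r+p≡1+b′)))

    b+r<b′+p : b + r < b′ + p
    b+r<b′+p with b + r <? b′ + p
    ... | yes b+r<b′+p = b+r<b′+p
    ... | no b+r≮b′+p with ≤-offset {s} {r} s+r≤v
      where
      s+r≤v : s + r ≤ v
      s+r≤v = ≤-by-sum (r + b′ + p + suc b) 0 (long ⊕ ≮⇒≥ b+r≮b′+p ⊕ ≤-reflexive (sym v+p≡1+b))
                (solve (s ∷ r ∷ b′ ∷ p ∷ b ∷ [])) (solve (v ∷ r ∷ b′ ∷ p ∷ b ∷ []))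
    ...   | i , s≤i , i+r≡v = ⊥-elim (F-right-maximal v v+p≡1+b (begin
      T v            ≡⟨ cong T (sym i+r≡v) ⟩
      T (i + r)      ≡⟨ sym (perG i s≤i (≤-trans (≤-reflexive i+r≡v) (<⇒≤ (≤-<-trans v≤b b<b′)))) ⟩
      T i            ≡⟨ perF i (≤-trans a≤s s≤i) (≤-trans (+-monoʳ-≤ i p≤r) (≤-trans (≤-reflexive i+r≡v) v≤b)) ⟩
      T (i + p)      ≡⟨ perG (i + p) (≤-trans s≤i (m≤m+n i p)) (subst (_≤ b′) (sym i+p+r≡1+b) b<b′) ⟩
      T (i + p + r)  ≡⟨ cong T i+p+r≡v+p ⟩
      T (v + p)      ∎))
      where
      v≤b : v ≤ b
      v≤b = ≤-by-sum (p + 1) 0 (≤-reflexive v+p≡1+b ⊕ 1≤p) (solve (v ∷ p ∷ [])) (solve (b ∷ p ∷ []))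
      i+p+r≡v+p : i + p + r ≡ v + p
      i+p+r≡v+p = trans (+-right-comm i p r) (cong (_+ p) i+r≡v)
      i+p+r≡1+b : i + p + r ≡ suc b
      i+p+r≡1+b = trans i+p+r≡v+p v+p≡1+b

    window : ∀ k → k < p → T (u + k) ≡ T (u + k + r)
    window k k<p = perG (u + k) (≤-trans s≤u (m≤m+n u k))
      (≤-by-sum (1 + p) 0 (k<p ⊕ ≤-reflexive u+r+p≡1+b′) (solve (u ∷ k ∷ r ∷ p ∷ [])) (solve (p ∷ b′ ∷ [])))

    a<x⇒x+r≤a′ : a < x → x + r ≤ suc a₀
    a<x⇒x+r≤a′ a<x with x + r ≤? suc a₀
    ... | yes x+r≤a′ = x+r≤a′
    ... | no x+r≰a′ = ⊥-elim (run-left-maximal R x₀ 1+x₀≡x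
          (shift-transfer T perF perF′ 1≤p (≤-trans a≤s s≤u) u+p≤1+b a′≤u+r
             (subst (_≤ suc b′) (+-right-comm u r p) (≤-reflexive u+r+p≡1+b′)) window
             x₀ a≤x₀ x₀≤b a′≤x₀+r x₀+r≤b′))
      where
      x₀ : ℕ
      x₀ = pred x
      1+x₀≡x : suc x₀ ≡ x
      1+x₀≡x = suc-pred x {{>-nonZero (≤-trans (s≤s z≤n) a<x)}}
      a≤x₀ : a ≤ x₀
      a≤x₀ = s≤s⁻¹ (subst (a <_) (sym 1+x₀≡x) a<x)
      a′≤x₀+r : suc a₀ ≤ x₀ + r
      a′≤x₀+r = s≤s⁻¹ (subst (λ z → suc a₀ < z + r) (sym 1+x₀≡x) (≰⇒> x+r≰a′))
      x+r≤1+b′ : x + r ≤ suc b′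
      x+r≤1+b′ = ≤-by-sum (s + r) r (x≤s ⊕ long) (solve (x ∷ r ∷ s ∷ [])) (solve (s ∷ b′ ∷ r ∷ []))
      x₀+r≤b′ : x₀ + r ≤ b′
      x₀+r≤b′ = s≤s⁻¹ (subst (λ z → z + r ≤ suc b′) (sym 1+x₀≡x) x+r≤1+b′)
      x₀≤b : x₀ ≤ b
      x₀≤b = +-cancelʳ-≤ r x₀ b (≤-trans x₀+r≤b′ b′≤b+r)
      u+p≤1+b : u + p ≤ suc b
      u+p≤1+b = ≤-by-sum (r + b′) 0 (≤-reflexive u+r+p≡1+b′ ⊕ b′≤b+r)
                  (solve (u ∷ p ∷ r ∷ b′ ∷ [])) (solve (b ∷ r ∷ b′ ∷ []))
      a′≤u+r : suc a₀ ≤ u + r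
      a′≤u+r = ≤-by-sum (2 * p + suc b′) p (longF′ ⊕ ≤-reflexive (sym u+r+p≡1+b′))
                 (solve (a₀ ∷ p ∷ b′ ∷ [])) (solve (u ∷ r ∷ p ∷ b′ ∷ []))

  right-shift : ∀ {x y r s} → IsRun n T x y r → 4 * p ≤ r → IsPer T s b′ r → s + 2 * r ≤ suc b′
    → a ≤ s → x ≤ s → b′ ≤ y → Σ ℕ (RightShift x y r)
  right-shift {x} {y} {r} {s} R 4p≤r G long a≤s x≤s b′≤y
    with ≤-offset {s} {r + p} {suc b′} (≤-by-sum r 0 (long ⊕ <⇒≤ (p<r 4p≤r)) (solve (s ∷ r ∷ p ∷ [])) (solve (r ∷ b′ ∷ [])))
       | ≤-offset a+p≤1+b
  ... | u , s≤u , u+[r+p]≡1+b′ | v , _ , v+p≡1+b = u , record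
    { b′≤b+r = b′≤b+r ; b+r<b′+p = b+r<b′+p ; u+r+p≡1+b′ = u+r+p≡1+b′
    ; a≤u = ≤-trans a≤s s≤u ; x≤u = ≤-trans x≤s s≤u
    ; u+r≤1+y = ≤-trans (m≤m+n (u + r) p) (≤-trans (≤-reflexive u+r+p≡1+b′) (s≤s b′≤y))
    ; window = window ; a<x⇒x+r≤a′ = a<x⇒x+r≤a′ }
    where
    u+r+p≡1+b′ : u + r + p ≡ suc b′
    u+r+p≡1+b′ = trans (+-assoc u r p) u+[r+p]≡1+b′
    open RightRun R 4p≤r G long a≤s x≤s s≤u u+r+p≡1+b′ v+p≡1+b

  left-shift-≮ : ∀ {y₁ y₂ r₁ r₂} → LeftShift y₁ r₁ → LeftShift y₂ r₂ → ¬ r₁ < r₂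
  left-shift-≮ {r₁ = r₁} L₁ L₂ r₁<r₂ with <-offset r₁<r₂
  ... | d , 0<d , refl = <⇒≱ d<p (per≤window-period T (run-isPer F′) 0<d L₁.a′≤a+r bound window-d)
    where
    module L₁ = LeftShift L₁
    module L₂ = LeftShift L₂
    d<p : d < p
    d<p = ≤-by-sum (a + r₁ + suc a₀) 0 (L₂.a+r<a′+p ⊕ L₁.a′≤a+r)
            (solve (a ∷ r₁ ∷ d ∷ a₀ ∷ [])) (solve (a ∷ r₁ ∷ a₀ ∷ p ∷ []))
    bound : a + r₁ + p + d ≤ suc b′
    bound = ≤-by-sum (2 + a₀ + p) 1 (L₂.a+r<a′+p ⊕ longF′)
              (solve (a ∷ r₁ ∷ d ∷ a₀ ∷ p ∷ [])) (solve (a₀ ∷ p ∷ b′ ∷ []))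
    window-d : ∀ k → k < p → T (a + r₁ + k) ≡ T (a + r₁ + k + d)
    window-d k k<p = begin
      T (a + r₁ + k)        ≡⟨ cong T (+-right-comm a r₁ k) ⟩
      T (a + k + r₁)        ≡⟨ sym (L₁.window k k<p) ⟩
      T (a + k)             ≡⟨ L₂.window k k<p ⟩
      T (a + k + (r₁ + d))  ≡⟨ cong T (solve (a ∷ k ∷ r₁ ∷ d ∷ [])) ⟩
      T (a + r₁ + k + d)    ∎

  right-shift-≮ : ∀ {x₁ y₁ x₂ y₂ r₁ r₂ u₁ u₂} → RightShift x₁ y₁ r₁ u₁ → RightShift x₂ y₂ r₂ u₂ → ¬ r₁ < r₂
  right-shift-≮ {r₁ = r₁} {u₁ = u₁} {u₂} R₁ R₂ r₁<r₂ with <-offset r₁<r₂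
  ... | d , 0<d , refl = <⇒≱ d<p (per≤window-period T (run-isPer F) 0<d R₂.a≤u bound window-d)
    where
    module R₁ = RightShift R₁
    module R₂ = RightShift R₂
    u₁≡u₂+d : u₁ ≡ u₂ + d
    u₁≡u₂+d = +-cancelʳ-≡ (r₁ + p) u₁ (u₂ + d) (begin
      u₁ + (r₁ + p)      ≡⟨ sym (+-assoc u₁ r₁ p) ⟩
      u₁ + r₁ + p        ≡⟨ trans R₁.u+r+p≡1+b′ (sym R₂.u+r+p≡1+b′) ⟩
      u₂ + (r₁ + d) + p  ≡⟨ solve (u₂ ∷ r₁ ∷ d ∷ p ∷ []) ⟩
      u₂ + d + (r₁ + p)  ∎)
    d<p : d < p
    d<p = ≤-by-sum (b′ + b + r₁) 0 (R₁.b′≤b+r ⊕ R₂.b+r<b′+p)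
            (solve (b′ ∷ b ∷ r₁ ∷ d ∷ [])) (solve (b ∷ r₁ ∷ b′ ∷ p ∷ []))
    bound : u₂ + p + d ≤ suc b
    bound = ≤-by-sum (u₁ + r₁ + b′) 0 (≤-reflexive R₁.u+r+p≡1+b′ ⊕ R₁.b′≤b+r ⊕ ≤-reflexive (sym u₁≡u₂+d))
              (solve (u₁ ∷ u₂ ∷ r₁ ∷ d ∷ p ∷ b′ ∷ [])) (solve (u₁ ∷ r₁ ∷ b ∷ b′ ∷ []))
    window-d : ∀ k → k < p → T (u₂ + k) ≡ T (u₂ + k + d)
    window-d k k<p = begin
      T (u₂ + k)             ≡⟨ R₂.window k k<p ⟩
      T (u₂ + k + (r₁ + d))  ≡⟨ cong T (solve (u₂ ∷ k ∷ r₁ ∷ d ∷ [])) ⟩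
      T (u₂ + d + k + r₁)    ≡⟨ cong (λ z → T (z + k + r₁)) (sym u₁≡u₂+d) ⟩
      T (u₁ + k + r₁)        ≡⟨ sym (R₁.window k k<p) ⟩
      T (u₁ + k)             ≡⟨ cong (λ z → T (z + k)) u₁≡u₂+d ⟩
      T (u₂ + d + k)         ≡⟨ cong T (+-right-comm u₂ d k) ⟩
      T (u₂ + k + d)         ∎

  left-right-exclusive : ∀ {y₁ x₂ y₂ r₁ r₂ u₂} → LeftShift y₁ r₁ → y₁ < b′ → RightShift x₂ y₂ r₂ u₂ → a < x₂ → ⊥
  left-right-exclusive {y₁} {x₂} {y₂} {r₁} {r₂} L y₁<b′ R a<x₂ = <-irrefl refl 1≤0
    where
    module L = LeftShift L
    module R = RightShift R
    1≤0 : 1 ≤ 0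
    1≤0 = ≤-by-sum (b + r₁ + y₁ + b′ + x₂ + r₂ + a₀ + a + 2) 1
            (L.y<b′⇒b+r≤y y₁<b′ ⊕ y₁<b′ ⊕ R.b′≤b+r ⊕ R.a<x⇒x+r≤a′ a<x₂ ⊕ L.a′≤a+r ⊕ a<x₂)
            (solve (b ∷ r₁ ∷ y₁ ∷ b′ ∷ x₂ ∷ r₂ ∷ a₀ ∷ a ∷ [])) (solve (b ∷ r₁ ∷ y₁ ∷ b′ ∷ x₂ ∷ r₂ ∷ a₀ ∷ a ∷ []))

  -- With a < a′ and b < b′, R ∩ (F ∪ F′) is the fragment T[x ⊔ a .. y ⊓ b′].
  record PyramidRun (x y r : ℕ) : Set where
    field
      run : IsRun n T x y r
      4p≤r : 4 * p ≤ r
      cap-nonempty : x ⊔ a ≤ y ⊓ b′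
      cap-periodic : PeriodicWith T (x ⊔ a) (y ⊓ b′) r

  pyramid-run : ∀ {x y} → InPyramid n T a b (suc a₀) b′ p x y → Σ ℕ (PyramidRun x y)
  pyramid-run {x} {y} (r , R , _ , 4p≤r , s≤e , G) = r , record
    { run = R ; 4p≤r = 4p≤r
    ; cap-nonempty = subst₂ _≤_ x⊔[a⊓a′]≡x⊔a y⊓[b⊔b′]≡y⊓b′ s≤e
    ; cap-periodic = subst₂ (λ s e → PeriodicWith T s e r) x⊔[a⊓a′]≡x⊔a y⊓[b⊔b′]≡y⊓b′ G }
    where
    x⊔[a⊓a′]≡x⊔a : x ⊔ (a ⊓ suc a₀) ≡ x ⊔ a
    x⊔[a⊓a′]≡x⊔a = cong (x ⊔_) (m≤n⇒m⊓n≡m (m≤n⇒m≤1+n a≤a₀))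
    y⊓[b⊔b′]≡y⊓b′ : y ⊓ (b ⊔ b′) ≡ y ⊓ b′
    y⊓[b⊔b′]≡y⊓b′ = cong (y ⊓_) (m≤n⇒m⊔n≡n (<⇒≤ b<b′))

  pyramid-left : ∀ {x y r} → PyramidRun x y r → x ≤ a → LeftShift y r
  pyramid-left {x} {y} {r} P x≤a =
    left-shift run 4p≤r (proj₁ cap) (periodic⇒long a≤e cap) (m⊓n≤m y b′) (m⊓n≤n y b′)
    where
    open PyramidRun P
    x⊔a≡a : x ⊔ a ≡ a
    x⊔a≡a = m≤n⇒m⊔n≡n x≤a
    a≤e : a ≤ y ⊓ b′
    a≤e = subst (_≤ y ⊓ b′) x⊔a≡a cap-nonempty
    cap : PeriodicWith T a (y ⊓ b′) r
    cap = subst (λ s → PeriodicWith T s (y ⊓ b′) r) x⊔a≡a cap-periodic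

  pyramid-right : ∀ {x y r} → PyramidRun x y r → b′ ≤ y → Σ ℕ (RightShift x y r)
  pyramid-right {x} {y} {r} P b′≤y =
    right-shift run 4p≤r (proj₁ cap) (periodic⇒long s≤b′ cap) (m≤n⊔m x a) (m≤m⊔n x a) b′≤y
    where
    open PyramidRun P
    y⊓b′≡b′ : y ⊓ b′ ≡ b′
    y⊓b′≡b′ = m≥n⇒m⊓n≡n b′≤y
    s≤b′ : x ⊔ a ≤ b′
    s≤b′ = subst (x ⊔ a ≤_) y⊓b′≡b′ cap-nonempty
    cap : PeriodicWith T (x ⊔ a) b′ r
    cap = subst (λ e → PeriodicWith T (x ⊔ a) e r) y⊓b′≡b′ cap-periodic

  left-runs-equal : ∀ {x₁ y₁ x₂ y₂ r₁ r₂} → PyramidRun x₁ y₁ r₁ → PyramidRun x₂ y₂ r₂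
    → x₁ ≤ a → x₂ ≤ a → x₁ ≡ x₂ × y₁ ≡ y₂
  left-runs-equal P₁ P₂ x₁≤a x₂≤a
    with L₁ ← pyramid-left P₁ x₁≤a | L₂ ← pyramid-left P₂ x₂≤a
    with refl ← ≤-antisym (≮⇒≥ (left-shift-≮ L₂ L₁)) (≮⇒≥ (left-shift-≮ L₁ L₂))
    = runs-equal (PyramidRun.run P₁) (PyramidRun.run P₂) x₁≤a x₂≤a
        (LeftShift.a+r≤1+y L₁) (LeftShift.a+r≤1+y L₂)

  right-runs-equal : ∀ {x₁ y₁ x₂ y₂ r₁ r₂} → PyramidRun x₁ y₁ r₁ → PyramidRun x₂ y₂ r₂
    → b′ ≤ y₁ → b′ ≤ y₂ → x₁ ≡ x₂ × y₁ ≡ y₂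
  right-runs-equal {r₁ = r} P₁ P₂ b′≤y₁ b′≤y₂
    with u₁ , R₁ ← pyramid-right P₁ b′≤y₁ | u₂ , R₂ ← pyramid-right P₂ b′≤y₂
    with refl ← ≤-antisym (≮⇒≥ (right-shift-≮ R₂ R₁)) (≮⇒≥ (right-shift-≮ R₁ R₂))
    with refl ← +-cancelʳ-≡ r u₁ u₂ (+-cancelʳ-≡ p (u₁ + r) (u₂ + r)
                  (trans (RightShift.u+r+p≡1+b′ R₁) (sym (RightShift.u+r+p≡1+b′ R₂))))
    = runs-equal (PyramidRun.run P₁) (PyramidRun.run P₂) (RightShift.x≤u R₁) (RightShift.x≤u R₂)
        (RightShift.u+r≤1+y R₁) (RightShift.u+r≤1+y R₂)

  outer-runs-equal : ∀ {x₁ y₁ x₂ y₂ r₁ r₂} → PyramidRun x₁ y₁ r₁ → PyramidRun x₂ y₂ r₂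
    → ¬ (a < x₁ × y₁ < b′) → ¬ (a < x₂ × y₂ < b′) → x₁ ≡ x₂ × y₁ ≡ y₂
  outer-runs-equal {x₁} {y₁} {x₂} {y₂} P₁ P₂ outer₁ outer₂ with x₁ ≤? a | x₂ ≤? a | b′ ≤? y₁ | b′ ≤? y₂
  ... | yes x₁≤a | yes x₂≤a | _ | _ = left-runs-equal P₁ P₂ x₁≤a x₂≤a
  ... | _ | _ | yes b′≤y₁ | yes b′≤y₂ = right-runs-equal P₁ P₂ b′≤y₁ b′≤y₂
  ... | no x₁≰a | _ | no b′≰y₁ | _ = ⊥-elim (outer₁ (≰⇒> x₁≰a , ≰⇒> b′≰y₁))
  ... | _ | no x₂≰a | _ | no b′≰y₂ = ⊥-elim (outer₂ (≰⇒> x₂≰a , ≰⇒> b′≰y₂))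
  ... | yes x₁≤a | no x₂≰a | no b′≰y₁ | yes b′≤y₂ =
    ⊥-elim (left-right-exclusive (pyramid-left P₁ x₁≤a) (≰⇒> b′≰y₁) (proj₂ (pyramid-right P₂ b′≤y₂)) (≰⇒> x₂≰a))
  ... | no x₁≰a | yes x₂≤a | yes b′≤y₁ | no b′≰y₂ =
    ⊥-elim (left-right-exclusive (pyramid-left P₂ x₂≤a) (≰⇒> b′≰y₂) (proj₂ (pyramid-right P₁ b′≤y₁)) (≰⇒> x₁≰a))

lemma18 : {A : Set} (_<ₐ_ : A → A → Set) → IsStrictTotalOrder _≡_ _<ₐ_
    → (n : ℕ) (T : ℕ → A) (a b a′ b′ p : ℕ)
    → IsRun n T a b p → IsRun n T a′ b′ p
    → Neighboring a b a′ b′ → a < a′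
    → Σ (ℕ → A) (λ L → IsLyndonRoot _<ₐ_ T a p L × IsLyndonRoot _<ₐ_ T a′ p L)
    → ∀ x₁ y₁ x₂ y₂
    → InPyramid n T a b a′ b′ p x₁ y₁ → ¬ (a < x₁ × y₁ < b′)
    → InPyramid n T a b a′ b′ p x₂ y₂ → ¬ (a < x₂ × y₂ < b′)
    → x₁ ≡ x₂ × y₁ ≡ y₂
lemma18 _ _ n T a b (suc a₀) b′ p F F′ (_ , _ , z≤1+b , a′≤z , _) (s≤s a≤a₀) _ x₁ y₁ x₂ y₂ P₁ outer₁ P₂ outer₂ =
  outer-runs-equal (proj₂ (pyramid-run P₁)) (proj₂ (pyramid-run P₂)) outer₁ outer₂
  where open NeighbouringRuns F F′ a≤a₀ (s≤s⁻¹ (≤-trans a′≤z z≤1+b))
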